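{- Let $W=\langle w_1,\dots,w_n\rangle$ be a weave. (i) If $|V(W)|\ge 3$ and $W$ is prime, then $W$ is isomorphic to $T_m$ or $U_m$ for some odd $m$. (ii) If $|V(W)|\ge 2$, $v\notin V(W)$ is a vertex such that $v\to w_i$ for all odd $i$ and $w_i\to v$ for all even $i$, and the tournament $W+v$ induced on $V(W)\cup\{v\}$ is prime, then $W+v$ is isomorphic to $T_m$, $U_m$, or $W_m$ for some odd $m$.
   Context: A tournament has exactly one directed edge between any two distinct vertices. A homogeneous set of $G$ is $X\subseteq V(G)$ such that each $v\notin X$ either beats all of $X$ or is beaten by all of $X$; it is nontrivial if $1<|X|<|V(G)|$, and $G$ is prime if it has no nontrivial homogeneous set. A weave $\langle w_1,\dots,w_n\rangle$ is a tournament on $w_1,\dots,w_n$ such that: $w_i\to w_j$ whenever $i<j$ and $i,j$ have opposite parity; either $w_i\to w_j$ for all odd $i<j$, or $w_j\to w_i$ for all odd $i<j$; and either $w_i\to w_j$ for all even $i<j$, or $w_j\to w_i$ for all even $i<j$. For odd $m=2k+1$: $T_m$ has vertices $v_1,\dots,v_m$ with $v_i\to v_j$ iff $j\equiv i+1,\dots,i+k\pmod m$; $U_m$ is $T_m$ with all edges inside $\{v_1,\dots,v_k\}$ reversed; $W_m$ has vertices $w_1,\dots,w_m$ with $w_i\to w_j$ for $1\le i<j\le m-1$, and $w_2,w_4,\dots,w_{m-1}$ all beat $w_m$, which beats all of $w_1,w_3,\dots,w_{m-2}$. -}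

module Defs where

open import Data.Nat using (ℕ; zero; suc; _+_; _*_; _∸_; _<_; _%_)
open import Data.Nat.Properties using (_≟_; _<?_)
open import Data.Bool using (Bool; true; false; not; if_then_else_; _∧_)
open import Data.Fin using (Fin; toℕ; zero; suc)
open import Data.Fin.Subset using (Subset; _∈_; _∉_; ∣_∣)
open import Data.Product using (Σ; _×_; _,_)
open import Data.Sum using (_⊎_)
open import Relation.Nullary using (¬_)
open import Relation.Nullary.Decidable using (⌊_⌋)
open import Relation.Binary.PropositionalEquality using (_≡_; _≢_)
open import Function.Bundles using (_↔_; Inverse)

-- A directed "adjacency" on vertex set Fin n:  A i j ≡ true  means  i → j.
Adj : ℕ → Set
Adj n = Fin n → Fin n → Bool

record IsTournament {n : ℕ} (A : Adj n) : Set where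
  field
    irrefl : ∀ i → A i i ≡ false
    oneEdge : ∀ i j → i ≢ j → A j i ≡ not (A i j)

IsHomogeneous : {n : ℕ} → Adj n → Subset n → Set
IsHomogeneous {n} A X =
  ∀ (v : Fin n) → v ∉ X →
    (∀ x → x ∈ X → A v x ≡ true) ⊎ (∀ x → x ∈ X → A x v ≡ true)

IsPrime : {n : ℕ} → Adj n → Set
IsPrime {n} A = ∀ (X : Subset n) → 1 < ∣ X ∣ → ∣ X ∣ < n → ¬ IsHomogeneous A X

-- Parity of a 0-based index.  Vertex  i : Fin n  stands for  w_(toℕ i + 1),
-- so "w_i with i odd" corresponds to toℕ i even.
evenB : ℕ → Bool
evenB k = ⌊ k % 2 ≟ 0 ⌋

record IsWeave {n : ℕ} (A : Adj n) : Set where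
  field
    opposite : ∀ i j → toℕ i < toℕ j → evenB (toℕ i) ≡ not (evenB (toℕ j)) → A i j ≡ true
    oddClass :
      (∀ i j → toℕ i < toℕ j → evenB (toℕ i) ≡ true → evenB (toℕ j) ≡ true → A i j ≡ true)
      ⊎ (∀ i j → toℕ i < toℕ j → evenB (toℕ i) ≡ true → evenB (toℕ j) ≡ true → A j i ≡ true)
    evenClass :
      (∀ i j → toℕ i < toℕ j → evenB (toℕ i) ≡ false → evenB (toℕ j) ≡ false → A i j ≡ true)
      ⊎ (∀ i j → toℕ i < toℕ j → evenB (toℕ i) ≡ false → evenB (toℕ j) ≡ false → A j i ≡ true)

Iso : {n m : ℕ} → Adj n → Adj m → Set
Iso {n} {m} A B =
  Σ (Fin n ↔ Fin m) λ f → ∀ i j → B (Inverse.to f i) (Inverse.to f j) ≡ A i j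

-- T_m for m = 2k+1, vertices v_1..v_m as Fin m (v_(i+1) = i):
-- v_i → v_j iff (j - i) mod m ∈ {1,…,k}.
T : (k : ℕ) → Adj (suc (k + k))
T k i j = let m = suc (k + k)
              d = ((toℕ j + m) ∸ toℕ i) % m
          in ⌊ 0 <? d ⌋ ∧ ⌊ d <? suc k ⌋

-- U_m: T_m with all edges inside {v_1,…,v_k} (indices < k) reversed.
U : (k : ℕ) → Adj (suc (k + k))
U k i j = if ⌊ toℕ i <? k ⌋ ∧ ⌊ toℕ j <? k ⌋ then T k j i else T k i j

-- W_m for m = 2k+1, w_(i+1) = i, last vertex index 2k.
-- w_i → w_j for i<j≤m-1; w_2,w_4,…,w_(m-1) beat w_m; w_m beats w_1,w_3,…,w_(m-2).
W : (k : ℕ) → Adj (suc (k + k))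
W k i j =
  if ⌊ toℕ j ≟ k + k ⌋ then (if ⌊ toℕ i ≟ k + k ⌋ then false else not (evenB (toℕ i)))
  else (if ⌊ toℕ i ≟ k + k ⌋ then evenB (toℕ j) else ⌊ toℕ i <? toℕ j ⌋)

-- W + v: new vertex v = zero, old vertex w_(k+1) = suc k.
-- v → w_i for odd i (toℕ even), w_i → v for even i.
extend : {n : ℕ} → Adj n → Adj (suc n)
extend A zero zero = false
extend A zero (suc j) = evenB (toℕ j)
extend A (suc i) zero = not (evenB (toℕ i))
extend A (suc i) (suc j) = A i j

module Submission where

-- The edges between the two parity classes of a weave all point forward, so a weave on
-- w₁, …, w_n is determined by n and by the direction (ascending or descending) of each class.
-- If the odd class ascends, w₁ is a source.  If n is even, w_n is a sink (even class ascending)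
-- or {w₁, w_n} is homogeneous (both classes descending).  In the remaining cases n = 2k + 1, the
-- odd class descends, and reading the odd class downwards from v_m and the even class downwards
-- from v_k identifies the weave with T_m (even class descending) or U_m (even class ascending).
-- For W + v: if the even class of W descends, v is just a new first vertex of a weave and (i)
-- applies.  Otherwise, for n even, moving v to the end turns W + v into W_m (odd class
-- ascending) or into the weave of length m that is isomorphic to U_m; for n odd, w_n is a sink
-- or {v, w_n} is homogeneous.

open import Defs
open import Data.Nat using (ℕ; _≤_)
open import Data.Product using (Σ; _×_)
open import Data.Sum using (_⊎_)

open import Data.Bool using (Bool; true; false; not; if_then_else_; _∧_)
open import Data.Bool.Properties using (not-involutive; not-injective; ∧-zeroʳ; ¬-not) renaming (_≟_ to _≟ᵇ_)
open import Data.Fin using (Fin; zero; suc; toℕ; fromℕ; fromℕ<; inject₁; lower₁)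
open import Data.Fin.Properties
  using (≤fromℕ; toℕ<n; toℕ-fromℕ<; toℕ-injective; toℕ-fromℕ; toℕ-inject₁; inject₁-lower₁; lower₁-inject₁′)
  renaming (≤∧≢⇒< to ≤∧≢⇒<ᶠ; <⇒≢ to <⇒≢ᶠ)
open import Data.Fin.Subset using (Subset; _∈_; _∉_; ∣_∣; ∁; ⁅_⁆; _∪_)
open import Data.Fin.Subset.Properties
  using (x∉∁p⇒x∈p; x∈∁p⇒x∉p; x∈⁅y⁆⇒x≡y; x∈⁅x⁆; x∈p∪q⁻; x∈p∪q⁺; ∪-identityˡ; ∪-identityʳ; ∣⁅x⁆∣≡1; ∣∁p∣≡n∸∣p∣)
open import Data.Nat using (zero; suc; _+_; _∸_; _<_; _≮_; z≤n; s≤s; s≤s⁻¹; _<?_; _≤?_; _%_; ⌊_/2⌋)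
open import Data.Nat.DivMod using (m<n⇒m%n≡m; [m+n]%n≡m%n; n%n≡0)
open import Data.Nat.Properties
open import Data.Nat.Tactic.RingSolver using (solve-∀)
open import Data.Product using (∃; _,_)
import Data.Product as Σ
open import Data.Sum using (inj₁; inj₂; [_,_])
import Data.Sum as Sum
open import Function using (_∘_)
open import Function.Bundles using (_⇔_; _↔_; Inverse; Injection; mk↔ₛ′; mk⇔)
open import Function.Construct.Composition using (_↔-∘_)
open import Function.Properties.Inverse using (↔⇒↣)
open import Relation.Binary.Definitions using (tri<; tri≈; tri>)
open import Relation.Binary.PropositionalEquality hiding ([_])
open import Relation.Nullary using (¬_; yes; no; contradiction)
open import Relation.Nullary.Decidable using (Dec; ⌊_⌋; dec-true; dec-false; isYes≗does; does-⇔)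

evenB-suc : ∀ n → evenB (suc n) ≡ not (evenB n)
evenB-suc 0 = refl
evenB-suc 1 = refl
evenB-suc (suc (suc n)) = evenB-suc n

evenB-double : ∀ a → evenB (a + a) ≡ true
evenB-double zero = refl
evenB-double (suc a) rewrite +-suc a a = evenB-double a

evenB-suc-double : ∀ a → evenB (suc (a + a)) ≡ false
evenB-suc-double a rewrite evenB-suc (a + a) | evenB-double a = refl

even-or-odd : ∀ n → (∃ λ a → n ≡ a + a) ⊎ (∃ λ b → n ≡ suc (b + b))
even-or-odd zero = inj₁ (0 , refl)
even-or-odd (suc n) with even-or-odd n
... | inj₁ (a , n≡a+a) = inj₂ (a , cong suc n≡a+a)
... | inj₂ (b , n≡1+b+b) = inj₁ (suc b , trans (cong suc n≡1+b+b) (cong suc (sym (+-suc b b))))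

evenB-suc⁻¹ : ∀ x p → evenB (suc x) ≡ not p → evenB x ≡ p
evenB-suc⁻¹ x _ eq = not-injective (trans (sym (evenB-suc x)) eq)

m<n⇒∃[o]m+1+o≡n : ∀ {m n} → m < n → ∃ λ o → m + suc o ≡ n
m<n⇒∃[o]m+1+o≡n {m} m<n with m≤n⇒∃[o]m+o≡n m<n
... | o , 1+m+o≡n = o , trans (+-suc m o) 1+m+o≡n

m+m≤n+n⇒m≤n : ∀ {m n} → m + m ≤ n + n → m ≤ n
m+m≤n+n⇒m≤n {m} {n} m+m≤n+n with m ≤? n
... | yes m≤n = m≤n
... | no m≰n = contradiction m+m≤n+n (<⇒≱ (+-mono-< (≰⇒> m≰n) (≰⇒> m≰n)))

m+m<n+n⇒m<n : ∀ {m n} → m + m < n + n → m < n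
m+m<n+n⇒m<n {m} {n} m+m<n+n with m <? n
... | yes m<n = m<n
... | no m≮n = contradiction m+m<n+n (≤⇒≯ (+-mono-≤ (≮⇒≥ m≮n) (≮⇒≥ m≮n)))

m+n≡[m+o]+p⇒p+o≡n : ∀ a e p p′ → a + p ≡ (a + e) + p′ → p′ + e ≡ p
m+n≡[m+o]+p⇒p+o≡n a e p p′ eq =
  sym (trans (+-cancelˡ-≡ a p (e + p′) (trans eq (+-assoc a e p′))) (+-comm e p′))

opposite-parities : ∀ b c → b ≡ not c → (b ≡ true × c ≡ false) ⊎ (b ≡ false × c ≡ true)
opposite-parities true false _ = inj₁ (refl , refl)
opposite-parities false true _ = inj₂ (refl , refl)

⌊⌋-true : ∀ {a} {A : Set a} (a? : Dec A) → A → ⌊ a? ⌋ ≡ true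
⌊⌋-true a? a = trans (isYes≗does a?) (dec-true a? a)

⌊⌋-false : ∀ {a} {A : Set a} (a? : Dec A) → ¬ A → ⌊ a? ⌋ ≡ false
⌊⌋-false a? ¬a = trans (isYes≗does a?) (dec-false a? ¬a)

⌊⌋-⇔ : ∀ {a b} {A : Set a} {B : Set b} → A ⇔ B → (a? : Dec A) (b? : Dec B) → ⌊ a? ⌋ ≡ ⌊ b? ⌋
⌊⌋-⇔ A⇔B a? b? = trans (isYes≗does a?) (trans (does-⇔ A⇔B a? b?) (sym (isYes≗does b?)))

≤?-complement : ∀ m n → ⌊ m <? suc n ⌋ ≡ not ⌊ suc n <? suc m ⌋
≤?-complement m n with m ≤? n
... | yes m≤n =
  trans (⌊⌋-true (m <? suc n) (s≤s m≤n)) (cong not (sym (⌊⌋-false (suc n <? suc m) (≤⇒≯ m≤n ∘ s≤s⁻¹))))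
... | no m≰n =
  trans (⌊⌋-false (m <? suc n) (m≰n ∘ s≤s⁻¹)) (cong not (sym (⌊⌋-true (suc n <? suc m) (s≤s (≰⇒> m≰n)))))

-- Weaves

-- IsWeave A consists of OppositeForward A and ClassOrder _ p A for p = true (odd class) and
-- p = false (even class).
ClassOrder : ∀ {n} → Bool → Bool → Adj n → Set
ClassOrder true p A = ∀ i j → toℕ i < toℕ j → evenB (toℕ i) ≡ p → evenB (toℕ j) ≡ p → A i j ≡ true
ClassOrder false p A = ∀ i j → toℕ i < toℕ j → evenB (toℕ i) ≡ p → evenB (toℕ j) ≡ p → A j i ≡ true

OppositeForward : ∀ {n} → Adj n → Set
OppositeForward A = ∀ i j → toℕ i < toℕ j → evenB (toℕ i) ≡ not (evenB (toℕ j)) → A i j ≡ true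

weaveForward : Bool → Bool → ℕ → ℕ → Bool
weaveForward ascₒ ascₑ x y with evenB x | evenB y
... | true | true = ascₒ
... | false | false = ascₑ
... | _ | _ = true

weaveEdge : Bool → Bool → ℕ → ℕ → Bool
weaveEdge ascₒ ascₑ x y with x <? y | y <? x
... | yes _ | _ = weaveForward ascₒ ascₑ x y
... | no _ | yes _ = not (weaveForward ascₒ ascₑ y x)
... | no _ | no _ = false

-- The weave ⟨0, 1, …, n-1⟩; ascₒ orders its odd class (the w_i with i odd, at even positions)
-- and ascₑ its even class.
Weave : Bool → Bool → (n : ℕ) → Adj n
Weave ascₒ ascₑ n i j = weaveEdge ascₒ ascₑ (toℕ i) (toℕ j)

module _ {n} {A : Adj n} (tA : IsTournament A) where
  open IsTournament tA

  loses⇒¬beats : ∀ {i j} → i ≢ j → A j i ≡ true → A i j ≡ false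
  loses⇒¬beats {i} {j} i≢j Aji = trans (oneEdge j i (i≢j ∘ sym)) (cong not Aji)

  ClassOrder⇒edge : ∀ asc {p} → ClassOrder asc p A →
                    ∀ {i j} → toℕ i < toℕ j → evenB (toℕ i) ≡ p → evenB (toℕ j) ≡ p → A i j ≡ asc
  ClassOrder⇒edge true ord i<j ei ej = ord _ _ i<j ei ej
  ClassOrder⇒edge false ord i<j ei ej = loses⇒¬beats (<⇒≢ᶠ i<j) (ord _ _ i<j ei ej)

  forward-≡-weaveForward : ∀ ascₒ ascₑ → OppositeForward A →
                           ClassOrder ascₒ true A → ClassOrder ascₑ false A →
                           ∀ i j → toℕ i < toℕ j → A i j ≡ weaveForward ascₒ ascₑ (toℕ i) (toℕ j)
  forward-≡-weaveForward ascₒ ascₑ opp ordₒ ordₑ i j i<j with evenB (toℕ i) in ei | evenB (toℕ j) in ej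
  ... | true | true = ClassOrder⇒edge ascₒ ordₒ i<j ei ej
  ... | false | false = ClassOrder⇒edge ascₑ ordₑ i<j ei ej
  ... | true | false = opp i j i<j (trans ei (cong not (sym ej)))
  ... | false | true = opp i j i<j (trans ei (cong not (sym ej)))

  ≡-Weave : ∀ ascₒ ascₑ → OppositeForward A → ClassOrder ascₒ true A → ClassOrder ascₑ false A →
            ∀ i j → A i j ≡ Weave ascₒ ascₑ n i j
  ≡-Weave ascₒ ascₑ opp ordₒ ordₑ i j with toℕ i <? toℕ j | toℕ j <? toℕ i
  ... | yes i<j | _ = forward-≡-weaveForward ascₒ ascₑ opp ordₒ ordₑ i j i<j
  ... | no _ | yes j<i =
    trans (oneEdge j i (<⇒≢ᶠ j<i)) (cong not (forward-≡-weaveForward ascₒ ascₑ opp ordₒ ordₑ j i j<i))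
  ... | no i≮j | no j≮i rewrite toℕ-injective (≤-antisym (≮⇒≥ j≮i) (≮⇒≥ i≮j)) = irrefl j

weaveEdge-irrefl : ∀ ascₒ ascₑ x → weaveEdge ascₒ ascₑ x x ≡ false
weaveEdge-irrefl ascₒ ascₑ x with x <? x
... | yes x<x = contradiction x<x (<-irrefl refl)
... | no _ = refl

weaveEdge-< : ∀ ascₒ ascₑ {x y} → x < y → weaveEdge ascₒ ascₑ x y ≡ weaveForward ascₒ ascₑ x y
weaveEdge-< ascₒ ascₑ {x} {y} x<y with x <? y
... | yes _ = refl
... | no x≮y = contradiction x<y x≮y

weaveEdge-> : ∀ ascₒ ascₑ {x y} → y < x → weaveEdge ascₒ ascₑ x y ≡ not (weaveForward ascₒ ascₑ y x)
weaveEdge-> ascₒ ascₑ {x} {y} y<x with x <? y | y <? x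
... | yes x<y | _ = contradiction x<y (<⇒≯ y<x)
... | no _ | yes _ = refl
... | no _ | no y≮x = contradiction y<x y≮x

weaveForward-toOdd : ∀ ascₑ x y → evenB y ≡ true → weaveForward false ascₑ x y ≡ not (evenB x)
weaveForward-toOdd ascₑ x y even-y with evenB x | evenB y
... | true | true = refl
... | false | true = refl
... | _ | false with () ← even-y

weaveForward-ascending : ∀ x y → weaveForward true true x y ≡ true
weaveForward-ascending x y with evenB x | evenB y
... | true | true = refl
... | true | false = refl
... | false | true = refl
... | false | false = refl

weaveEdge-ascending : ∀ x y → weaveEdge true true x y ≡ ⌊ x <? y ⌋
weaveEdge-ascending x y with x <? y | y <? x
... | yes _ | _ = weaveForward-ascending x y
... | no _ | yes _ = cong not (weaveForward-ascending y x)
... | no _ | no _ = refl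

-- Homogeneous sets

∣⁅x⁆∪⁅y⁆∣≡2 : ∀ {n} {x y : Fin n} → x ≢ y → ∣ ⁅ x ⁆ ∪ ⁅ y ⁆ ∣ ≡ 2
∣⁅x⁆∪⁅y⁆∣≡2 {x = zero} {zero} x≢y = contradiction refl x≢y
∣⁅x⁆∪⁅y⁆∣≡2 {x = zero} {suc y} _ = cong suc (trans (cong ∣_∣ (∪-identityˡ ⁅ y ⁆)) (∣⁅x⁆∣≡1 y))
∣⁅x⁆∪⁅y⁆∣≡2 {x = suc x} {zero} _ = cong suc (trans (cong ∣_∣ (∪-identityʳ ⁅ x ⁆)) (∣⁅x⁆∣≡1 x))
∣⁅x⁆∪⁅y⁆∣≡2 {x = suc x} {suc y} x≢y = ∣⁅x⁆∪⁅y⁆∣≡2 (x≢y ∘ cong suc)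

Source Sink : ∀ {n} → Adj n → Fin n → Set
Source A u = ∀ x → x ≢ u → A u x ≡ true
Sink A u = ∀ x → x ≢ u → A x u ≡ true

Twins : ∀ {n} → Adj n → Fin n → Fin n → Set
Twins A u w = ∀ v → v ≢ u → v ≢ w → (A v u ≡ true × A v w ≡ true) ⊎ (A u v ≡ true × A w v ≡ true)

module _ {n} (A : Adj n) (3≤n : 3 ≤ n) where

  source-or-sink⇒¬prime : ∀ u → Source A u ⊎ Sink A u → ¬ IsPrime A
  source-or-sink⇒¬prime u extremal prime = prime (∁ ⁅ u ⁆) 1<∣X∣ ∣X∣<n (homogeneous extremal)
    where
    ∣X∣≡n∸1 : ∣ ∁ ⁅ u ⁆ ∣ ≡ n ∸ 1
    ∣X∣≡n∸1 = trans (∣∁p∣≡n∸∣p∣ ⁅ u ⁆) (cong (n ∸_) (∣⁅x⁆∣≡1 u))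
    1<∣X∣ : 1 < ∣ ∁ ⁅ u ⁆ ∣
    1<∣X∣ = subst (1 <_) (sym ∣X∣≡n∸1) (∸-monoˡ-≤ 1 3≤n)
    ∣X∣<n : ∣ ∁ ⁅ u ⁆ ∣ < n
    ∣X∣<n = subst (_< n) (sym ∣X∣≡n∸1) (∸-monoʳ-< {o = 0} ≤-refl (≤-trans (s≤s z≤n) 3≤n))
    ≢u : ∀ {x} → x ∈ ∁ ⁅ u ⁆ → x ≢ u
    ≢u x∈X refl = x∈∁p⇒x∉p x∈X (x∈⁅x⁆ u)
    homogeneous : Source A u ⊎ Sink A u → IsHomogeneous A (∁ ⁅ u ⁆)
    homogeneous extremal v v∉X with x∈⁅y⁆⇒x≡y u (x∉∁p⇒x∈p v∉X) | extremal
    ... | refl | inj₁ beatsAll = inj₁ λ x x∈X → beatsAll x (≢u x∈X)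
    ... | refl | inj₂ losesAll = inj₂ λ x x∈X → losesAll x (≢u x∈X)

  twins⇒¬prime : ∀ u w → u ≢ w → Twins A u w → ¬ IsPrime A
  twins⇒¬prime u w u≢w twins prime = prime X 1<∣X∣ ∣X∣<n homogeneous
    where
    X : Subset n
    X = ⁅ u ⁆ ∪ ⁅ w ⁆
    1<∣X∣ : 1 < ∣ X ∣
    1<∣X∣ = subst (1 <_) (sym (∣⁅x⁆∪⁅y⁆∣≡2 u≢w)) ≤-refl
    ∣X∣<n : ∣ X ∣ < n
    ∣X∣<n = subst (_< n) (sym (∣⁅x⁆∪⁅y⁆∣≡2 u≢w)) 3≤n
    ∈X : ∀ {x} → x ∈ X → x ≡ u ⊎ x ≡ w
    ∈X x∈X with x∈p∪q⁻ ⁅ u ⁆ ⁅ w ⁆ x∈X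
    ... | inj₁ x∈⁅u⁆ = inj₁ (x∈⁅y⁆⇒x≡y u x∈⁅u⁆)
    ... | inj₂ x∈⁅w⁆ = inj₂ (x∈⁅y⁆⇒x≡y w x∈⁅w⁆)
    ≢u : ∀ {v} → v ∉ X → v ≢ u
    ≢u v∉X refl = v∉X (x∈p∪q⁺ (inj₁ (x∈⁅x⁆ u)))
    ≢w : ∀ {v} → v ∉ X → v ≢ w
    ≢w v∉X refl = v∉X (x∈p∪q⁺ {p = ⁅ u ⁆} (inj₂ (x∈⁅x⁆ w)))
    homogeneous : IsHomogeneous A X
    homogeneous v v∉X with twins v (≢u v∉X) (≢w v∉X)
    ... | inj₁ (Avu , Avw) = inj₁ λ x x∈X → [ (λ { refl → Avu }) , (λ { refl → Avw }) ] (∈X x∈X)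
    ... | inj₂ (Auv , Awv) = inj₂ λ x x∈X → [ (λ { refl → Auv }) , (λ { refl → Awv }) ] (∈X x∈X)

-- Relabelling vertices

Iso-respˡ : ∀ {n m} {A A′ : Adj n} {B : Adj m} → (∀ i j → A i j ≡ A′ i j) → Iso A′ B → Iso A B
Iso-respˡ A≗A′ (π , iso) = π , λ i j → trans (iso i j) (sym (A≗A′ i j))

Iso-trans : ∀ {n m l} {A : Adj n} {B : Adj m} {C : Adj l} → Iso A B → Iso B C → Iso A C
Iso-trans (π , A≅B) (ρ , B≅C) =
  ρ ↔-∘ π , λ i j → trans (B≅C (Inverse.to π i) (Inverse.to π j)) (A≅B i j)

restrict : ∀ {n} (f : ℕ → ℕ) → (∀ x → x < n → f x < n) → Fin n → Fin n
restrict f f< i = fromℕ< (f< (toℕ i) (toℕ<n i))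

toℕ-restrict : ∀ {n} (f : ℕ → ℕ) (f< : ∀ x → x < n → f x < n) i → toℕ (restrict f f< i) ≡ f (toℕ i)
toℕ-restrict f f< i = toℕ-fromℕ< _

restrict-↔ : ∀ {n} (f g : ℕ → ℕ) (f< : ∀ x → x < n → f x < n) (g< : ∀ y → y < n → g y < n) →
             (∀ y → y < n → f (g y) ≡ y) → (∀ x → x < n → g (f x) ≡ x) → Fin n ↔ Fin n
restrict-↔ f g f< g< fg gf = mk↔ₛ′ (restrict f f<) (restrict g g<) (inverse f g f< g< fg) (inverse g f g< f< gf)
  where
  inverse : ∀ f g f< g< → (∀ y → y < _ → f (g y) ≡ y) → ∀ y → restrict f f< (restrict g g< y) ≡ y
  inverse f g f< g< fg y = toℕ-injective (begin
    toℕ (restrict f f< (restrict g g< y)) ≡⟨ toℕ-restrict f f< _ ⟩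
    f (toℕ (restrict g g< y))             ≡⟨ cong f (toℕ-restrict g g< y) ⟩
    f (g (toℕ y))                         ≡⟨ fg (toℕ y) (toℕ<n y) ⟩
    toℕ y                                 ∎)
    where open ≡-Reasoning

pullback : ∀ {n m} → Adj m → (Fin n → Fin m) → Adj n
pullback B f i j = B (f i) (f j)

pullback-isTournament : ∀ {n m} {B : Adj m} {f : Fin n → Fin m} → IsTournament B →
                        (∀ {i j} → f i ≡ f j → i ≡ j) → IsTournament (pullback B f)
pullback-isTournament {f = f} tB f-inj = record
  { irrefl = λ i → IsTournament.irrefl tB (f i)
  ; oneEdge = λ i j i≢j → IsTournament.oneEdge tB (f i) (f j) (i≢j ∘ f-inj)
  }

module _ (n : ℕ) where

  firstToLast : Fin (suc n) → Fin (suc n)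
  firstToLast zero = fromℕ n
  firstToLast (suc i) = inject₁ i

  lastToFirst : Fin (suc n) → Fin (suc n)
  lastToFirst x with n ≟ toℕ x
  ... | yes _ = zero
  ... | no n≢x = suc (lower₁ x n≢x)

  rotate : Fin (suc n) ↔ Fin (suc n)
  rotate = mk↔ₛ′ firstToLast lastToFirst firstToLast-lastToFirst lastToFirst-firstToLast
    where
    firstToLast-lastToFirst : ∀ x → firstToLast (lastToFirst x) ≡ x
    firstToLast-lastToFirst x with n ≟ toℕ x
    ... | yes n≡x = toℕ-injective (trans (toℕ-fromℕ n) n≡x)
    ... | no n≢x = inject₁-lower₁ x n≢x
    lastToFirst-firstToLast : ∀ x → lastToFirst (firstToLast x) ≡ x
    lastToFirst-firstToLast zero with n ≟ toℕ (fromℕ n)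
    ... | yes _ = refl
    ... | no n≢n = contradiction (sym (toℕ-fromℕ n)) n≢n
    lastToFirst-firstToLast (suc i) with n ≟ toℕ (inject₁ i)
    ... | yes n≡i = contradiction (trans n≡i (toℕ-inject₁ i)) (<⇒≢ (toℕ<n i) ∘ sym)
    ... | no n≢i = cong suc (lower₁-inject₁′ i n≢i)

-- The tournaments T_m and U_m

module _ (k : ℕ) where
  private
    m : ℕ
    m = suc (k + k)

  T-ahead : ∀ {x y : Fin m} d → toℕ x + suc d ≡ toℕ y → T k x y ≡ ⌊ suc d <? suc k ⌋
  T-ahead {x} {y} d x+1+d≡y = cong (λ g → ⌊ 0 <? g ⌋ ∧ ⌊ g <? suc k ⌋) gap
    where
    open ≡-Reasoning
    1+d≤y : suc d ≤ toℕ y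
    1+d≤y = subst (suc d ≤_) x+1+d≡y (m≤n+m (suc d) (toℕ x))
    gap : ((toℕ y + m) ∸ toℕ x) % m ≡ suc d
    gap = begin
      ((toℕ y + m) ∸ toℕ x) % m         ≡⟨ cong (λ z → ((z + m) ∸ toℕ x) % m) x+1+d≡y ⟨
      ((toℕ x + suc d + m) ∸ toℕ x) % m ≡⟨ cong (λ z → (z ∸ toℕ x) % m) (+-assoc (toℕ x) (suc d) m) ⟩
      ((toℕ x + (suc d + m)) ∸ toℕ x) % m ≡⟨ cong (_% m) (m+n∸m≡n (toℕ x) (suc d + m)) ⟩
      (suc d + m) % m                   ≡⟨ [m+n]%n≡m%n (suc d) m ⟩
      suc d % m                         ≡⟨ m<n⇒m%n≡m (≤-trans (s≤s 1+d≤y) (toℕ<n y)) ⟩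
      suc d                             ∎

  T-behind : ∀ {x y : Fin m} d → toℕ y + suc d ≡ toℕ x → T k x y ≡ ⌊ k <? suc d ⌋
  T-behind {x} {y} d y+1+d≡x = trans (cong (λ g → ⌊ 0 <? g ⌋ ∧ ⌊ g <? suc k ⌋) gap) inRange
    where
    open ≡-Reasoning
    d<k+k : d < k + k
    d<k+k = ≤-trans (subst (suc d ≤_) y+1+d≡x (m≤n+m (suc d) (toℕ y))) (s≤s⁻¹ (toℕ<n x))
    gap : ((toℕ y + m) ∸ toℕ x) % m ≡ (k + k) ∸ d
    gap = begin
      ((toℕ y + m) ∸ toℕ x) % m           ≡⟨ cong (λ z → ((toℕ y + m) ∸ z) % m) y+1+d≡x ⟨
      ((toℕ y + m) ∸ (toℕ y + suc d)) % m ≡⟨ cong (_% m) ([m+n]∸[m+o]≡n∸o (toℕ y) m (suc d)) ⟩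
      ((k + k) ∸ d) % m                   ≡⟨ m<n⇒m%n≡m (s≤s (m∸n≤m (k + k) d)) ⟩
      (k + k) ∸ d                         ∎
    k+k∸k≡k : (k + k) ∸ k ≡ k
    k+k∸k≡k = m+n∸n≡m k k
    gap≤k⇔k≤d : (k + k) ∸ d < suc k ⇔ k < suc d
    gap≤k⇔k≤d = mk⇔
      (λ gap≤k → s≤s (∸-cancelʳ-≤ (m≤m+n k k)
                        (subst ((k + k) ∸ d ≤_) (sym k+k∸k≡k) (s≤s⁻¹ gap≤k))))
      (λ k≤d → s≤s (subst ((k + k) ∸ d ≤_) k+k∸k≡k (∸-monoʳ-≤ (k + k) (s≤s⁻¹ k≤d))))
    inRange : ⌊ 0 <? (k + k) ∸ d ⌋ ∧ ⌊ (k + k) ∸ d <? suc k ⌋ ≡ ⌊ k <? suc d ⌋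
    inRange rewrite ⌊⌋-true (0 <? (k + k) ∸ d) (m+n≤o⇒m≤o∸n 1 d<k+k) = ⌊⌋-⇔ gap≤k⇔k≤d _ _

  T-ahead-true : ∀ {x y : Fin m} d → toℕ x + suc d ≡ toℕ y → d < k → T k x y ≡ true
  T-ahead-true d x+1+d≡y d<k = trans (T-ahead d x+1+d≡y) (⌊⌋-true (suc d <? suc k) (s≤s d<k))

  T-behind-true : ∀ {x y : Fin m} d → toℕ y + suc d ≡ toℕ x → k ≤ d → T k x y ≡ true
  T-behind-true d y+1+d≡x k≤d = trans (T-behind d y+1+d≡x) (⌊⌋-true (k <? suc d) (s≤s k≤d))

  T-irrefl : ∀ x → T k x x ≡ false
  T-irrefl x =
    cong (λ g → ⌊ 0 <? g ⌋ ∧ ⌊ g <? suc k ⌋) (trans (cong (_% m) (m+n∸m≡n (toℕ x) m)) (n%n≡0 m))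

  T-isTournament : IsTournament (T k)
  T-isTournament = record { irrefl = T-irrefl ; oneEdge = antisym }
    where
    antisym : ∀ x y → x ≢ y → T k y x ≡ not (T k x y)
    antisym x y x≢y with <-cmp (toℕ x) (toℕ y)
    ... | tri≈ _ x≡y _ = contradiction (toℕ-injective x≡y) x≢y
    ... | tri< x<y _ _ with m<n⇒∃[o]m+1+o≡n x<y
    ...   | d , x+1+d≡y rewrite T-behind d x+1+d≡y | T-ahead d x+1+d≡y = ≤?-complement k d
    antisym x y x≢y | tri> _ _ y<x with m<n⇒∃[o]m+1+o≡n y<x
    ...   | d , y+1+d≡x rewrite T-ahead d y+1+d≡x | T-behind d y+1+d≡x | ≤?-complement k d = sym (not-involutive _)

reverseInside : ∀ {n} → (Fin n → Bool) → Adj n → Adj n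
reverseInside P A i j = if P i ∧ P j then A j i else A i j

reverseInside-isTournament : ∀ {n} (P : Fin n → Bool) {A : Adj n} →
                             IsTournament A → IsTournament (reverseInside P A)
reverseInside-isTournament P {A} tA = record { irrefl = irrefl′ ; oneEdge = oneEdge′ }
  where
  open IsTournament tA
  irrefl′ : ∀ i → reverseInside P A i i ≡ false
  irrefl′ i with P i
  ... | true = irrefl i
  ... | false = irrefl i
  oneEdge′ : ∀ i j → i ≢ j → reverseInside P A j i ≡ not (reverseInside P A i j)
  oneEdge′ i j i≢j with P i | P j
  ... | true | true = oneEdge j i (i≢j ∘ sym)
  ... | true | false = oneEdge i j i≢j
  ... | false | true = oneEdge i j i≢j
  ... | false | false = oneEdge i j i≢j

module _ {n} (P : Fin n → Bool) (A : Adj n) {i j : Fin n} where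

  reverseInside-outsideˡ : P i ≡ false → reverseInside P A i j ≡ A i j
  reverseInside-outsideˡ Pi rewrite Pi = refl

  reverseInside-outsideʳ : P j ≡ false → reverseInside P A i j ≡ A i j
  reverseInside-outsideʳ Pj rewrite Pj | ∧-zeroʳ (P i) = refl

  reverseInside-inside : P i ≡ true → P j ≡ true → reverseInside P A i j ≡ A j i
  reverseInside-inside Pi Pj rewrite Pi | Pj = refl

U-isTournament : ∀ k → IsTournament (U k)
U-isTournament k = reverseInside-isTournament (λ i → ⌊ toℕ i <? k ⌋) (T-isTournament k)

data PositionView (k x : ℕ) : Set where
  even : ∀ a p → x ≡ a + a → a + p ≡ k → PositionView k x
  odd : ∀ b q → x ≡ suc (b + b) → b + suc q ≡ k → PositionView k x

positionView : ∀ k x → x < suc (k + k) → PositionView k x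
positionView k x x<m with even-or-odd x
... | inj₁ (a , refl) =
  let p , a+p≡k = m≤n⇒∃[o]m+o≡n (m+m≤n+n⇒m≤n {a} {k} (s≤s⁻¹ x<m)) in even a p refl a+p≡k
... | inj₂ (b , refl) =
  let q , b+1+q≡k = m<n⇒∃[o]m+1+o≡n (m+m<n+n⇒m<n {b} {k} (s≤s⁻¹ x<m)) in odd b q refl b+1+q≡k

-- Position x of the weave (w_(x+1)) goes to vertex v_(σ x + 1) of T: w₁, w₃, …, w_m become
-- v_m, v_(m-1), …, v_(k+1), and w₂, w₄, …, w_(m-1) become v_k, v_(k-1), …, v₁.
σ : ℕ → ℕ → ℕ
σ k x = if evenB x then k + (k ∸ ⌊ x /2⌋) else k ∸ suc ⌊ x /2⌋

σ⁻¹ : ℕ → ℕ → ℕ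
σ⁻¹ k y = if ⌊ y <? k ⌋ then suc ((k ∸ suc y) + (k ∸ suc y)) else ((k + k) ∸ y) + ((k + k) ∸ y)

σ-even : ∀ {k} a p → a + p ≡ k → σ k (a + a) ≡ k + p
σ-even a p refl rewrite evenB-double a | sym (n≡⌊n+n/2⌋ a) | m+n∸m≡n a p = refl

σ-odd : ∀ {k} b q → b + suc q ≡ k → σ k (suc (b + b)) ≡ q
σ-odd b q refl rewrite evenB-suc-double b | sym (n≡⌈n+n/2⌉ b) | +-comm b (suc q) = m+n∸n≡m q b

m+1+n≡o⇒n<o : ∀ {k} b q → b + suc q ≡ k → q < k
m+1+n≡o⇒n<o b q refl = m≤n+m (suc q) b

σ⁻¹-σ : ∀ k x → x < suc (k + k) → σ⁻¹ k (σ k x) ≡ x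
σ⁻¹-σ k x x<m with positionView k x x<m
... | even a p refl refl rewrite σ-even a p refl | ⌊⌋-false ((a + p + p) <? a + p) (m+n≮m (a + p) p)
      | [m+n]∸[m+o]≡n∸o (a + p) (a + p) p | m+n∸n≡m a p = refl
... | odd b q refl refl rewrite σ-odd b q refl | ⌊⌋-true (q <? b + suc q) (m+1+n≡o⇒n<o b q refl)
      | m+n∸n≡m b (suc q) = refl

σ-σ⁻¹ : ∀ k y → y < suc (k + k) → σ k (σ⁻¹ k y) ≡ y
σ-σ⁻¹ k y y<m with y <? k
... | yes y<k with m<n⇒∃[o]m+1+o≡n y<k
...   | b , refl rewrite +-suc y b | m+n∸m≡n y b = σ-odd b y (trans (+-suc b y) (cong suc (+-comm b y)))
σ-σ⁻¹ k y y<m | no y≮k with m≤n⇒∃[o]m+o≡n (≮⇒≥ y≮k)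
...   | p , refl rewrite [m+n]∸[m+o]≡n∸o k k p = σ-even (k ∸ p) p (m∸n+n≡m p≤k)
  where
  p≤k : p ≤ k
  p≤k = +-cancelˡ-≤ k p k (s≤s⁻¹ y<m)

σ-< : ∀ k x → x < suc (k + k) → σ k x < suc (k + k)
σ-< k x x<m with positionView k x x<m
... | even a p refl a+p≡k rewrite σ-even a p a+p≡k = s≤s (+-monoʳ-≤ k (subst (p ≤_) a+p≡k (m≤n+m p a)))
... | odd b q refl b+1+q≡k rewrite σ-odd b q b+1+q≡k =
  s≤s (≤-trans (<⇒≤ (m+1+n≡o⇒n<o b q b+1+q≡k)) (m≤m+n k k))

σ⁻¹-< : ∀ k y → y < suc (k + k) → σ⁻¹ k y < suc (k + k)
σ⁻¹-< k y y<m with y <? k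
... | yes y<k = s≤s (+-mono-< k∸1+y<k k∸1+y<k)
  where
  k∸1+y<k : k ∸ suc y < k
  k∸1+y<k = ∸-monoʳ-< {o = 0} (s≤s z≤n) y<k
... | no y≮k = s≤s (+-mono-≤ k+k∸y≤k k+k∸y≤k)
  where
  k+k∸y≤k : (k + k) ∸ y ≤ k
  k+k∸y≤k = subst ((k + k) ∸ y ≤_) (m+n∸m≡n k k) (∸-monoʳ-≤ (k + k) (≮⇒≥ y≮k))

behind-identity : ∀ k q e → q + suc (k + e) ≡ k + (suc q + e)
behind-identity = solve-∀

ahead-identity : ∀ b q p → q + suc (b + p) ≡ (b + suc q) + p
ahead-identity = solve-∀

module _ (k : ℕ) where
  private
    m : ℕ
    m = suc (k + k)

  relabel : Fin m ↔ Fin m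
  relabel = restrict-↔ (σ k) (σ⁻¹ k) (σ-< k) (σ⁻¹-< k) (σ-σ⁻¹ k) (σ⁻¹-σ k)

  private
    σᶠ : Fin m → Fin m
    σᶠ = Inverse.to relabel

  data High (i : Fin m) : Set where
    high : ∀ a p → toℕ i ≡ a + a → a + p ≡ k → toℕ (σᶠ i) ≡ k + p → High i

  data Low (i : Fin m) : Set where
    low : ∀ b q → toℕ i ≡ suc (b + b) → b + suc q ≡ k → toℕ (σᶠ i) ≡ q → Low i

  toℕ-σᶠ : ∀ i → toℕ (σᶠ i) ≡ σ k (toℕ i)
  toℕ-σᶠ = toℕ-restrict (σ k) (σ-< k)

  high? : ∀ i → evenB (toℕ i) ≡ true → High i
  high? i even-i with positionView k (toℕ i) (toℕ<n i)
  ... | even a p i≡2a a+p≡k =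
    high a p i≡2a a+p≡k (trans (toℕ-σᶠ i) (trans (cong (σ k) i≡2a) (σ-even a p a+p≡k)))
  ... | odd b _ i≡1+2b _ with () ← trans (sym even-i) (trans (cong evenB i≡1+2b) (evenB-suc-double b))

  low? : ∀ i → evenB (toℕ i) ≡ false → Low i
  low? i odd-i with positionView k (toℕ i) (toℕ<n i)
  ... | odd b q i≡1+2b b+1+q≡k =
    low b q i≡1+2b b+1+q≡k (trans (toℕ-σᶠ i) (trans (cong (σ k) i≡1+2b) (σ-odd b q b+1+q≡k)))
  ... | even a _ i≡2a _ with () ← trans (sym (evenB-double a)) (trans (cong evenB (sym i≡2a)) odd-i)

  high-high : ∀ {i j} → toℕ i < toℕ j → High i → High j → T k (σᶠ j) (σᶠ i) ≡ true
  high-high i<j (high a p i≡2a a+p≡k σi) (high a′ p′ j≡2a′ a′+p′≡k σj)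
    with m<n⇒∃[o]m+1+o≡n (m+m<n+n⇒m<n {a} {a′} (subst₂ _<_ i≡2a j≡2a′ i<j))
  ... | d , refl = T-ahead-true k d σj+1+d≡σi d<k
    where
    p′+1+d≡p : p′ + suc d ≡ p
    p′+1+d≡p = m+n≡[m+o]+p⇒p+o≡n a (suc d) p p′ (trans a+p≡k (sym a′+p′≡k))
    σj+1+d≡σi : toℕ (σᶠ _) + suc d ≡ toℕ (σᶠ _)
    σj+1+d≡σi = trans (cong (_+ suc d) σj) (trans (+-assoc k p′ (suc d)) (trans (cong (k +_) p′+1+d≡p) (sym σi)))
    d<k : d < k
    d<k = ≤-trans (subst (suc d ≤_) p′+1+d≡p (m≤n+m (suc d) p′)) (subst (p ≤_) a+p≡k (m≤n+m p a))

  low-low : ∀ {i j} → toℕ i < toℕ j → Low i → Low j → T k (σᶠ j) (σᶠ i) ≡ true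
  low-low i<j (low b q i≡1+2b b+1+q≡k σi) (low b′ q′ j≡1+2b′ b′+1+q′≡k σj)
    with m<n⇒∃[o]m+1+o≡n (m+m<n+n⇒m<n {b} {b′} (s≤s⁻¹ (subst₂ _<_ i≡1+2b j≡1+2b′ i<j)))
  ... | d , refl = T-ahead-true k d σj+1+d≡σi d<k
    where
    q′+1+d≡q : q′ + suc d ≡ q
    q′+1+d≡q =
      suc-injective (m+n≡[m+o]+p⇒p+o≡n b (suc d) (suc q) (suc q′) (trans b+1+q≡k (sym b′+1+q′≡k)))
    σj+1+d≡σi : toℕ (σᶠ _) + suc d ≡ toℕ (σᶠ _)
    σj+1+d≡σi = trans (cong (_+ suc d) σj) (trans q′+1+d≡q (sym σi))
    d<k : d < k
    d<k = ≤-trans (subst (suc d ≤_) q′+1+d≡q (m≤n+m (suc d) q′)) (<⇒≤ (m+1+n≡o⇒n<o b q b+1+q≡k))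

  high-low : ∀ {i j} → toℕ i < toℕ j → High i → Low j → T k (σᶠ i) (σᶠ j) ≡ true
  high-low i<j (high a p i≡2a a+p≡k σi) (low b q j≡1+2b b+1+q≡k σj)
    with m≤n⇒∃[o]m+o≡n (m+m≤n+n⇒m≤n {a} {b} (s≤s⁻¹ (subst₂ _<_ i≡2a j≡1+2b i<j)))
  ... | e , refl = T-behind-true k (k + e) σj+1+k+e≡σi (m≤m+n k e)
    where
    1+q+e≡p : suc q + e ≡ p
    1+q+e≡p = m+n≡[m+o]+p⇒p+o≡n a e p (suc q) (trans a+p≡k (sym b+1+q≡k))
    σj+1+k+e≡σi : toℕ (σᶠ _) + suc (k + e) ≡ toℕ (σᶠ _)
    σj+1+k+e≡σi =
      trans (cong (_+ suc (k + e)) σj) (trans (behind-identity k q e) (trans (cong (k +_) 1+q+e≡p) (sym σi)))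

  low-high : ∀ {i j} → toℕ i < toℕ j → Low i → High j → T k (σᶠ i) (σᶠ j) ≡ true
  low-high i<j (low b q i≡1+2b b+1+q≡k σi) (high a p j≡2a a+p≡k σj) = T-ahead-true k (b + p) σi+1+b+p≡σj b+p<k
    where
    b<a : b < a
    b<a = m+m<n+n⇒m<n (<-trans (n<1+n (b + b)) (subst₂ _<_ i≡1+2b j≡2a i<j))
    σi+1+b+p≡σj : toℕ (σᶠ _) + suc (b + p) ≡ toℕ (σᶠ _)
    σi+1+b+p≡σj =
      trans (cong (_+ suc (b + p)) σi) (trans (ahead-identity b q p) (trans (cong (_+ p) b+1+q≡k) (sym σj)))
    b+p<k : b + p < k
    b+p<k = subst (b + p <_) a+p≡k (+-monoˡ-< p b<a)

  private
    σᶠ-injective : ∀ {i j} → σᶠ i ≡ σᶠ j → i ≡ j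
    σᶠ-injective = Injection.injective (↔⇒↣ relabel)

    high-outside : ∀ {i} → High i → ⌊ toℕ (σᶠ i) <? k ⌋ ≡ false
    high-outside (high _ p _ _ σi) = ⌊⌋-false (toℕ (σᶠ _) <? k) (subst (_≮ k) (sym σi) (m+n≮m k p))

    low-inside : ∀ {i} → Low i → ⌊ toℕ (σᶠ i) <? k ⌋ ≡ true
    low-inside (low b q _ b+1+q≡k σi) =
      ⌊⌋-true (toℕ (σᶠ _) <? k) (subst (_< k) (sym σi) (m+1+n≡o⇒n<o b q b+1+q≡k))

  Weave≅T : Iso (Weave false false m) (T k)
  Weave≅T = relabel , ≡-Weave tR false false opposite oddClass evenClass
    where
    tR : IsTournament (pullback (T k) σᶠ)
    tR = pullback-isTournament (T-isTournament k) σᶠ-injective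
    opposite : OppositeForward (pullback (T k) σᶠ)
    opposite i j i<j parity with opposite-parities (evenB (toℕ i)) (evenB (toℕ j)) parity
    ... | inj₁ (ei , ej) = high-low i<j (high? i ei) (low? j ej)
    ... | inj₂ (ei , ej) = low-high i<j (low? i ei) (high? j ej)
    oddClass : ClassOrder false true (pullback (T k) σᶠ)
    oddClass i j i<j ei ej = high-high i<j (high? i ei) (high? j ej)
    evenClass : ClassOrder false false (pullback (T k) σᶠ)
    evenClass i j i<j ei ej = low-low i<j (low? i ei) (low? j ej)

  -- U reverses exactly the edges inside {v₁, …, v_k}, the image of the even class.
  Weave≅U : Iso (Weave false true m) (U k)
  Weave≅U = relabel , ≡-Weave tR false true opposite oddClass evenClass
    where
    P : Fin m → Bool
    P x = ⌊ toℕ x <? k ⌋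
    tR : IsTournament (pullback (U k) σᶠ)
    tR = pullback-isTournament (U-isTournament k) σᶠ-injective
    opposite : OppositeForward (pullback (U k) σᶠ)
    opposite i j i<j parity with opposite-parities (evenB (toℕ i)) (evenB (toℕ j)) parity
    ... | inj₁ (ei , ej) =
      trans (reverseInside-outsideˡ P (T k) (high-outside (high? i ei))) (high-low i<j (high? i ei) (low? j ej))
    ... | inj₂ (ei , ej) =
      trans (reverseInside-outsideʳ P (T k) (high-outside (high? j ej))) (low-high i<j (low? i ei) (high? j ej))
    oddClass : ClassOrder false true (pullback (U k) σᶠ)
    oddClass i j i<j ei ej =
      trans (reverseInside-outsideˡ P (T k) (high-outside (high? j ej))) (high-high i<j (high? i ei) (high? j ej))
    evenClass : ClassOrder true false (pullback (U k) σᶠ)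
    evenClass i j i<j ei ej =
      trans (reverseInside-inside P (T k) (low-inside (low? i ei)) (low-inside (low? j ej)))
            (low-low i<j (low? i ei) (low? j ej))

-- W + v

module _ {n} {A : Adj n} where

  extend-isTournament : IsTournament A → IsTournament (extend A)
  extend-isTournament tA = record { irrefl = irrefl′ ; oneEdge = oneEdge′ }
    where
    open IsTournament tA
    irrefl′ : ∀ i → extend A i i ≡ false
    irrefl′ zero = refl
    irrefl′ (suc i) = irrefl i
    oneEdge′ : ∀ i j → i ≢ j → extend A j i ≡ not (extend A i j)
    oneEdge′ zero zero 0≢0 = contradiction refl 0≢0
    oneEdge′ zero (suc j) _ = refl
    oneEdge′ (suc i) zero _ = sym (not-involutive _)
    oneEdge′ (suc i) (suc j) i≢j = oneEdge i j (i≢j ∘ cong suc)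

  extend-isWeave : IsWeave A → ClassOrder false false A → IsWeave (extend A)
  extend-isWeave wA descₑ = record
    { opposite = opposite
    ; oddClass = inj₂ oddClass
    ; evenClass = Sum.map (shift true) (shift false) (IsWeave.oddClass wA)
    }
    where
    opposite : OppositeForward (extend A)
    opposite zero (suc j) _ parity = evenB-suc⁻¹ (toℕ j) true (trans (sym (not-involutive _)) (cong not (sym parity)))
    opposite (suc i) (suc j) i<j parity = IsWeave.opposite wA i j (s≤s⁻¹ i<j)
      (not-injective (trans (sym (evenB-suc (toℕ i))) (trans parity (cong not (evenB-suc (toℕ j))))))
    oddClass : ClassOrder false true (extend A)
    oddClass zero (suc j) _ _ ej = cong not (evenB-suc⁻¹ (toℕ j) false ej)
    oddClass (suc i) (suc j) i<j ei ej =
      descₑ i j (s≤s⁻¹ i<j) (evenB-suc⁻¹ (toℕ i) false ei) (evenB-suc⁻¹ (toℕ j) false ej)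
    shift : ∀ asc → ClassOrder asc true A → ClassOrder asc false (extend A)
    shift true ord (suc i) (suc j) i<j ei ej =
      ord i j (s≤s⁻¹ i<j) (evenB-suc⁻¹ (toℕ i) true ei) (evenB-suc⁻¹ (toℕ j) true ej)
    shift false ord (suc i) (suc j) i<j ei ej =
      ord i j (s≤s⁻¹ i<j) (evenB-suc⁻¹ (toℕ i) true ei) (evenB-suc⁻¹ (toℕ j) true ej)

module _ (a : ℕ) {A : Adj (a + a)} where
  private
    N : ℕ
    N = a + a
    v↦last : Fin (suc N) → Fin (suc N)
    v↦last = firstToLast N

  extend≅Weave : ∀ ascₑ → (∀ i j → A i j ≡ Weave false ascₑ N i j) →
                 Iso (extend A) (Weave false ascₑ (suc N))
  extend≅Weave ascₑ A≗Weave = rotate N , edge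
    where
    edge : ∀ i j → Weave false ascₑ (suc N) (v↦last i) (v↦last j) ≡ extend A i j
    edge zero zero rewrite toℕ-fromℕ N = weaveEdge-irrefl false ascₑ N
    edge zero (suc j) rewrite toℕ-fromℕ N | toℕ-inject₁ j = begin
      weaveEdge false ascₑ N (toℕ j)              ≡⟨ weaveEdge-> false ascₑ (toℕ<n j) ⟩
      not (weaveForward false ascₑ (toℕ j) N)     ≡⟨ cong not (weaveForward-toOdd ascₑ (toℕ j) N (evenB-double a)) ⟩
      not (not (evenB (toℕ j)))                   ≡⟨ not-involutive _ ⟩
      evenB (toℕ j)                               ∎
      where open ≡-Reasoning
    edge (suc i) zero rewrite toℕ-fromℕ N | toℕ-inject₁ i =
      trans (weaveEdge-< false ascₑ (toℕ<n i)) (weaveForward-toOdd ascₑ (toℕ i) N (evenB-double a))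
    edge (suc i) (suc j) rewrite toℕ-inject₁ i | toℕ-inject₁ j = sym (A≗Weave i j)

  extend≅W : (∀ i j → A i j ≡ Weave true true N i j) → Iso (extend A) (W a)
  extend≅W A≗Weave = rotate N , edge
    where
    ≢N : ∀ (i : Fin N) → ⌊ toℕ i ≟ N ⌋ ≡ false
    ≢N i = ⌊⌋-false (toℕ i ≟ N) (<⇒≢ (toℕ<n i))
    edge : ∀ i j → W a (v↦last i) (v↦last j) ≡ extend A i j
    edge zero zero rewrite toℕ-fromℕ N | ⌊⌋-true (N ≟ N) refl = refl
    edge zero (suc j) rewrite toℕ-fromℕ N | toℕ-inject₁ j | ⌊⌋-true (N ≟ N) refl | ≢N j = refl
    edge (suc i) zero rewrite toℕ-fromℕ N | toℕ-inject₁ i | ⌊⌋-true (N ≟ N) refl | ≢N i = refl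
    edge (suc i) (suc j) rewrite toℕ-inject₁ i | toℕ-inject₁ j | ≢N i | ≢N j =
      sym (trans (A≗Weave i j) (weaveEdge-ascending (toℕ i) (toℕ j)))

-- Sources, sinks and homogeneous pairs in weaves

≢zero⇒0<toℕ : ∀ {n} {x : Fin (suc n)} → x ≢ zero → 0 < toℕ x
≢zero⇒0<toℕ x≢0 = ≤∧≢⇒<ᶠ z≤n (x≢0 ∘ sym)

≢fromℕ⇒<toℕ : ∀ {n} {x : Fin (suc n)} → x ≢ fromℕ n → toℕ x < toℕ (fromℕ n)
≢fromℕ⇒<toℕ {n} {x} x≢last = ≤∧≢⇒<ᶠ (≤fromℕ x) x≢last

evenB-last : ∀ n p → evenB n ≡ p → evenB (toℕ (fromℕ n)) ≡ p
evenB-last n _ eq = trans (cong evenB (toℕ-fromℕ n)) eq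

module _ {n} {A : Adj n} (opp : OppositeForward A) where

  ascending⇒beats-later : ∀ {p} → ClassOrder true p A →
                          ∀ i j → toℕ i < toℕ j → evenB (toℕ i) ≡ p → A i j ≡ true
  ascending⇒beats-later {p} ord i j i<j ei with evenB (toℕ j) ≟ᵇ p
  ... | yes ej = ord i j i<j ei ej
  ... | no ej≢p = opp i j i<j (trans ei (¬-not (ej≢p ∘ sym)))

  ascending⇒beaten-by-earlier : ∀ {p} → ClassOrder true p A →
                                ∀ i j → toℕ i < toℕ j → evenB (toℕ j) ≡ p → A i j ≡ true
  ascending⇒beaten-by-earlier {p} ord i j i<j ej with evenB (toℕ i) ≟ᵇ p
  ... | yes ei = ord i j i<j ei ej
  ... | no ei≢p = opp i j i<j (trans (¬-not ei≢p) (cong not (sym ej)))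

module _ {m} {A : Adj (suc m)} (opp : OppositeForward A) where

  ascending⇒first-source : ClassOrder true true A → Source A zero
  ascending⇒first-source ascₒ x x≢0 = ascending⇒beats-later opp ascₒ zero x (≢zero⇒0<toℕ x≢0) refl

  ascending⇒last-sink : ClassOrder true false A → evenB m ≡ false → Sink A (fromℕ m)
  ascending⇒last-sink ascₑ odd-m x x≢last =
    ascending⇒beaten-by-earlier opp ascₑ x (fromℕ m) (≢fromℕ⇒<toℕ x≢last) (evenB-last m false odd-m)

  descending⇒first-last-twins : ClassOrder false true A → ClassOrder false false A → evenB m ≡ false →
                                Twins A zero (fromℕ m)
  descending⇒first-last-twins descₒ descₑ odd-m v v≢0 v≢last with evenB (toℕ v) in ev
  ... | true = inj₁ (descₒ zero v (≢zero⇒0<toℕ v≢0) refl ev ,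
                     opp v (fromℕ m) (≢fromℕ⇒<toℕ v≢last) (trans ev (cong not (sym (evenB-last m false odd-m)))))
  ... | false = inj₂ (opp zero v (≢zero⇒0<toℕ v≢0) (cong not (sym ev)) ,
                      descₑ v (fromℕ m) (≢fromℕ⇒<toℕ v≢last) ev (evenB-last m false odd-m))

module _ (b : ℕ) {A : Adj (suc (b + b))} (opp : OppositeForward A) where
  private
    last : Fin (suc (b + b))
    last = fromℕ (b + b)
    even-last : evenB (toℕ last) ≡ true
    even-last = evenB-last (b + b) true (evenB-double b)

  ascending⇒extend-last-sink : ClassOrder true true A → Sink (extend A) (suc last)
  ascending⇒extend-last-sink ascₒ zero _ = even-last
  ascending⇒extend-last-sink ascₒ (suc x) x≢last =
    ascending⇒beaten-by-earlier opp ascₒ x last (≢fromℕ⇒<toℕ (x≢last ∘ cong suc)) even-last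

  descending⇒extend-first-last-twins : ClassOrder false true A → Twins (extend A) zero (suc last)
  descending⇒extend-first-last-twins descₒ zero v≢0 _ = contradiction refl v≢0
  descending⇒extend-first-last-twins descₒ (suc x) _ x≢last with evenB (toℕ x) in ex
  ... | true = inj₂ (refl , descₒ x last (≢fromℕ⇒<toℕ (x≢last ∘ cong suc)) ex even-last)
  ... | false =
    inj₁ (refl , opp x last (≢fromℕ⇒<toℕ (x≢last ∘ cong suc)) (trans ex (cong not (sym even-last))))

weave-classification : ∀ n (A : Adj n) → IsTournament A → IsWeave A → 3 ≤ n → IsPrime A →
                       Σ ℕ λ k → Iso A (T k) ⊎ Iso A (U k)
weave-classification (suc n) A tA wA 3≤n prime
  with IsWeave.opposite wA | IsWeave.oddClass wA | IsWeave.evenClass wA | even-or-odd n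
... | opp | inj₁ ascₒ | _ | _ =
      contradiction prime (source-or-sink⇒¬prime A 3≤n zero (inj₁ (ascending⇒first-source opp ascₒ)))
... | opp | inj₂ descₒ | inj₁ ascₑ | inj₁ (k , refl) =
      k , inj₂ (Iso-respˡ {B = U k} (≡-Weave tA false true opp descₒ ascₑ) (Weave≅U k))
... | opp | inj₂ descₒ | inj₂ descₑ | inj₁ (k , refl) =
      k , inj₁ (Iso-respˡ {B = T k} (≡-Weave tA false false opp descₒ descₑ) (Weave≅T k))
... | opp | inj₂ _ | inj₁ ascₑ | inj₂ (b , refl) =
      contradiction prime (source-or-sink⇒¬prime A 3≤n (fromℕ n)
        (inj₂ (ascending⇒last-sink opp ascₑ (evenB-suc-double b))))
... | opp | inj₂ descₒ | inj₂ descₑ | inj₂ (b , refl) =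
      contradiction prime (twins⇒¬prime A 3≤n zero (fromℕ n) (λ ())
        (descending⇒first-last-twins opp descₒ descₑ (evenB-suc-double b)))

extension-classification : ∀ n (A : Adj n) → IsTournament A → IsWeave A → 2 ≤ n → IsPrime (extend A) →
                           Σ ℕ λ k → Iso (extend A) (T k) ⊎ (Iso (extend A) (U k) ⊎ Iso (extend A) (W k))
extension-classification n A tA wA 2≤n prime
  with IsWeave.opposite wA | IsWeave.oddClass wA | IsWeave.evenClass wA | even-or-odd n
... | _ | _ | inj₂ descₑ | _ =
      Σ.map₂ (Sum.map₂ inj₁) (weave-classification (suc n) (extend A)
        (extend-isTournament tA) (extend-isWeave wA descₑ) (s≤s 2≤n) prime)
... | opp | inj₁ ascₒ | inj₁ ascₑ | inj₁ (a , refl) =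
      a , inj₂ (inj₂ (extend≅W a (≡-Weave tA true true opp ascₒ ascₑ)))
... | opp | inj₂ descₒ | inj₁ ascₑ | inj₁ (a , refl) =
      a , inj₂ (inj₁ (Iso-trans {C = U a}
                        (extend≅Weave a true (≡-Weave tA false true opp descₒ ascₑ)) (Weave≅U a)))
... | opp | inj₁ ascₒ | inj₁ _ | inj₂ (b , refl) =
      contradiction prime (source-or-sink⇒¬prime (extend A) (s≤s 2≤n) (suc (fromℕ (b + b)))
        (inj₂ (ascending⇒extend-last-sink b opp ascₒ)))
... | opp | inj₂ descₒ | inj₁ _ | inj₂ (b , refl) =
      contradiction prime (twins⇒¬prime (extend A) (s≤s 2≤n) zero (suc (fromℕ (b + b))) (λ ())
        (descending⇒extend-first-last-twins b opp descₒ))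

corollary3p3 : (∀ (n : ℕ) (A : Adj n) → IsTournament A → IsWeave A → 3 ≤ n → IsPrime A →
    Σ ℕ λ k → Iso A (T k) ⊎ Iso A (U k))
    × (∀ (n : ℕ) (A : Adj n) → IsTournament A → IsWeave A → 2 ≤ n → IsPrime (extend A) →
    Σ ℕ λ k → Iso (extend A) (T k) ⊎ (Iso (extend A) (U k) ⊎ Iso (extend A) (W k)))
corollary3p3 = weave-classification , extension-classification
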